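{- Let $G$ be an oligomorphic permutation group of a countably infinite set $E$. If $\mathcal B$ and $\mathcal B'$ are block systems of $G$ all of whose blocks are finite, then their join in the lattice of set partitions of $E$ (the partition into classes of the equivalence relation generated by "being in the same block of $\mathcal B$ or of $\mathcal B'$") also has all of its blocks finite.
   Context: Oligomorphic: for each $n$, $G$ has finitely many orbits on $n$-element subsets of $E$. A block system is a partition of $E$ mapped to itself by every element of $G$. -}

module Defs where

open import Level using (0ℓ)
open import Data.Nat using (ℕ)
open import Data.Fin using (Fin)
open import Data.Vec using (Vec; lookup)
open import Data.List using (List)
open import Data.Product using (Σ; _×_; ∃; ∃-syntax; _,_; proj₁)
open import Data.Sum using (_⊎_)
open import Data.List.Membership.Propositional using (_∈_)
open import Function.Bundles using (_↔_; Inverse)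
open import Function.Definitions using (Injective)
open import Relation.Binary.PropositionalEquality using (_≡_)
open import Relation.Binary.Core using (Rel)
open import Relation.Binary.Structures using (IsEquivalence)
open import Relation.Binary.Construct.Closure.Equivalence using (EqClosure)

-- The countably infinite set E is taken to be ℕ (WLOG, via a bijection).
-- A permutation of E.
Perm : Set
Perm = ℕ ↔ ℕ

app : Perm → ℕ → ℕ
app g = Inverse.to g

idP : Perm → Set
idP g = ∀ x → app g x ≡ x

record IsPermGroup (G : Perm → Set) : Set where
  field
    has-id  : ∃[ e ] (G e × (∀ x → app e x ≡ x))
    closed-∘ : ∀ g h → G g → G h →
               ∃[ k ] (G k × (∀ x → app k x ≡ app g (app h x)))
    closed-⁻¹ : ∀ g → G g →
               ∃[ k ] (G k × (∀ x → app k x ≡ Inverse.from g x))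

Subset : ℕ → Set
Subset n = Σ (Vec ℕ n) (λ v → Injective _≡_ _≡_ (lookup v))

_∈ˢ_ : {n : ℕ} → ℕ → Subset n → Set
_∈ˢ_ {n} x S = ∃[ i ] (lookup (proj₁ S) i ≡ x)

MapsTo : {n : ℕ} → Perm → Subset n → Subset n → Set
MapsTo g T S = ∀ x → (∃[ y ] (y ∈ˢ T × app g y ≡ x)) ⇔' (x ∈ˢ S)
  where
  _⇔'_ : Set → Set → Set
  A ⇔' B = (A → B) × (B → A)

-- Oligomorphic: for each n, finitely many G-orbits on n-element subsets,
-- i.e. a finite list of representatives meeting every orbit.
Oligomorphic : (G : Perm → Set) → Set
Oligomorphic G = ∀ n → Σ (List (Subset n)) (λ reps → ∀ (S : Subset n) →
  ∃[ T ] (T ∈ reps × ∃[ g ] (G g × MapsTo g T S)))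

-- A block system of G: a partition of E (given by its equivalence relation
-- "in the same block") mapped to itself by every element of G.
record IsBlockSystem (G : Perm → Set) (R : Rel ℕ 0ℓ) : Set where
  field
    isEquivalence : IsEquivalence R
    invariant : ∀ g → G g → ∀ x y → (R x y → R (app g x) (app g y))
                                  × (R (app g x) (app g y) → R x y)

FiniteBlocks : Rel ℕ 0ℓ → Set
FiniteBlocks R = ∀ x → ∃[ L ] (∀ y → R x y → y ∈ L)

Join : Rel ℕ 0ℓ → Rel ℕ 0ℓ → Rel ℕ 0ℓ
Join R R' = EqClosure (λ x y → R x y ⊎ R' x y)

-- In the graph on E joining two points when they lie in a common block of B
-- or of B', every vertex has finitely many neighbours, the join classes are the
-- connected components, and G acts by automorphisms. Hence the graph distance
-- between two distinct points is an invariant of their G-orbit on 2-subsets.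
-- A shortest path x = x₀, x₁, …, x_k produces pairs {x, x_i} at the k distinct
-- distances 1, …, k, so k is at most the number r of such orbits. Every point
-- of the join class of x thus lies in the ball of radius r about x, which is finite.
module Submission where

open import Defs
open import Level using (Level; 0ℓ; _⊔_)
open import Data.Nat using (ℕ; zero; suc; _+_; _∸_; _≤_; _<_; z<s; s≤s; _≤?_)
open import Data.Nat.Properties
  using (_≟_; <-cmp; <-irrefl; ≰⇒>; m+[n∸m]≡n; +-monoˡ-<; suc-injective)
open import Data.Nat.Induction using (<-rec)
open import Data.Fin as Fin using (Fin; toℕ) renaming (zero to fzero; suc to fsuc)
open import Data.Fin.Properties using (pigeonhole; toℕ<n)
open import Data.Vec using (_∷_; []; lookup)
open import Data.List as List using (List; _∷_; _++_; concatMap; length)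
open import Data.List.Relation.Unary.Any using (here; there; index)
open import Data.List.Relation.Unary.Any.Properties using (lookup-index)
open import Data.List.Membership.Propositional using (_∈_; lose)
open import Data.List.Membership.Propositional.Properties using (∈-++⁺ˡ; ∈-++⁺ʳ; ∈-concatMap⁺)
open import Data.List.Membership.DecPropositional _≟_ using (_∈?_)
open import Data.Product using (_×_; ∃₂; ∃-syntax; _,_; proj₁; proj₂)
open import Data.Sum using (inj₁; inj₂)
open import Data.Empty using (⊥-elim)
open import Function using (id)
open import Function.Bundles using (Inverse; Injection)
open import Function.Properties.Inverse using (↔⇒↣)
open import Function.Definitions using (Injective)
open import Relation.Nullary using (¬_; yes; no)
open import Relation.Binary.Core using (Rel)
open import Relation.Binary.Definitions using (Symmetric; tri<; tri≈; tri>)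
open import Relation.Binary.PropositionalEquality
  using (_≡_; _≢_; refl; sym; trans; subst; subst₂)
open import Relation.Binary.Structures using (IsEquivalence)
open import Relation.Binary.Construct.Union as Union using (_∪_)
open import Relation.Binary.Construct.Closure.ReflexiveTransitive as Star using (Star; ε; _◅_)
import Relation.Binary.Construct.Closure.Symmetric as SymClosure

private
  variable
    a ℓ : Level
    A : Set a
    k m n : ℕ
    x y z u v : A

module _ {A : Set a} (S : Rel A ℓ) where

  infixr 5 _◅_

  data Walk : ℕ → A → A → Set (a ⊔ ℓ) where
    ε   : Walk 0 x x
    _◅_ : S x y → Walk n y z → Walk (suc n) x z

  Geodesic : ℕ → A → A → Set (a ⊔ ℓ)
  Geodesic n x y = Walk n x y × (∀ {m} → m < n → ¬ Walk m x y)

module _ {A : Set a} {S : Rel A ℓ} where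

  infixr 5 _◅◅_
  infixl 5 _▻_

  _◅◅_ : Walk S m x y → Walk S n y z → Walk S (m + n) x z
  ε       ◅◅ w = w
  (s ◅ v) ◅◅ w = s ◅ (v ◅◅ w)

  _▻_ : Walk S n x y → S y z → Walk S (suc n) x z
  ε       ▻ t = t ◅ ε
  (s ◅ w) ▻ t = s ◅ (w ▻ t)

  reverse : Symmetric S → Walk S n x y → Walk S n y x
  reverse S-sym ε       = ε
  reverse S-sym (s ◅ w) = reverse S-sym w ▻ S-sym s

  splitAt : ∀ m → m ≤ n → Walk S n x z → ∃[ y ] (Walk S m x y × Walk S (n ∸ m) y z)
  splitAt zero    _         w       = _ , ε , w
  splitAt (suc m) (s≤s m≤n) (s ◅ w) with y , front , back ← splitAt m m≤n w = y , s ◅ front , back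

  walk-map : (f : A → A) → (∀ {x y} → S x y → S (f x) (f y)) →
             Walk S n x y → Walk S n (f x) (f y)
  walk-map f f-pres ε       = ε
  walk-map f f-pres (s ◅ w) = f-pres s ◅ walk-map f f-pres w

  star⇒walk : Star S x y → ∃[ n ] Walk S n x y
  star⇒walk ε       = 0 , ε
  star⇒walk (s ◅ J) with n , w ← star⇒walk J = suc n , s ◅ w

  geodesic-length-unique : Geodesic S m x y → Geodesic S n x y → m ≡ n
  geodesic-length-unique {m} {n = n} (v , v-min) (w , w-min) with <-cmp m n
  ... | tri< m<n _ _ = ⊥-elim (w-min m<n v)
  ... | tri≈ _ m≡n _ = m≡n
  ... | tri> _ _ n<m = ⊥-elim (v-min n<m w)

  geodesic-reverse : Symmetric S → Geodesic S n x y → Geodesic S n y x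
  geodesic-reverse S-sym (w , w-min) =
    reverse S-sym w , λ m<n v → w-min m<n (reverse S-sym v)

  geodesic-suc⇒≢ : Geodesic S (suc n) x y → x ≢ y
  geodesic-suc⇒≢ (_ , w-min) refl = w-min z<s ε

  geodesic-prefix : m ≤ n → Geodesic S n x z → ∃[ y ] Geodesic S m x y
  geodesic-prefix {m} {n} m≤n (w , w-min) with y , front , back ← splitAt m m≤n w =
    y , front , λ k<m v → w-min (shortcut k<m) (v ◅◅ back)
    where
    shortcut : k < m → k + (n ∸ m) < n
    shortcut {k} k<m = subst (k + (n ∸ m) <_) (m+[n∸m]≡n m≤n) (+-monoˡ-< (n ∸ m) k<m)

  geodesic-reflect : (f g : A → A) → (∀ x → g (f x) ≡ x) →
                     (∀ {x y} → S x y → S (f x) (f y)) → (∀ {x y} → S x y → S (g x) (g y)) →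
                     Geodesic S n (f x) (f y) → Geodesic S n x y
  geodesic-reflect {x = x} {y} f g g∘f f-pres g-pres (w , w-min) =
    subst₂ (Walk S _) (g∘f x) (g∘f y) (walk-map g g-pres w) ,
    λ m<n v → w-min m<n (walk-map f f-pres v)

ball : (A → List A) → ℕ → A → List A
ball nbrs zero    x = x ∷ List.[]
ball nbrs (suc n) x = x ∷ concatMap (ball nbrs n) (nbrs x)

walk⇒∈ball : {S : Rel A ℓ} (nbrs : A → List A) → (∀ {x y} → S x y → y ∈ nbrs x) →
             Walk S m x y → m ≤ n → y ∈ ball nbrs n x
walk⇒∈ball {n = zero}  nbrs adj ε       _         = here refl
walk⇒∈ball {n = suc n} nbrs adj ε       _         = here refl
walk⇒∈ball {n = suc n} nbrs adj (s ◅ w) (s≤s m≤n) =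
  there (∈-concatMap⁺ (ball nbrs n) (lose (adj s) (walk⇒∈ball nbrs adj w m≤n)))

Invariant : (Perm → Set) → Rel ℕ 0ℓ → Set
Invariant G R = ∀ g → G g → ∀ x y → (R x y → R (app g x) (app g y))
                                  × (R (app g x) (app g y) → R x y)

module _ {R R' : Rel ℕ 0ℓ} where

  ∪-invariant : ∀ {G} → Invariant G R → Invariant G R' → Invariant G (R ∪ R')
  ∪-invariant inv inv' g Gg x y = forward , backward
    where
    forward : (R ∪ R') x y → (R ∪ R') (app g x) (app g y)
    forward (inj₁ r)  = inj₁ (proj₁ (inv g Gg x y) r)
    forward (inj₂ r') = inj₂ (proj₁ (inv' g Gg x y) r')
    backward : (R ∪ R') (app g x) (app g y) → (R ∪ R') x y
    backward (inj₁ r)  = inj₁ (proj₂ (inv g Gg x y) r)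
    backward (inj₂ r') = inj₂ (proj₂ (inv' g Gg x y) r')

  ∪-finiteBlocks : FiniteBlocks R → FiniteBlocks R' → FiniteBlocks (R ∪ R')
  ∪-finiteBlocks fin fin' x = proj₁ (fin x) ++ proj₁ (fin' x) , within
    where
    within : ∀ y → (R ∪ R') x y → y ∈ proj₁ (fin x) ++ proj₁ (fin' x)
    within y (inj₁ r)  = ∈-++⁺ˡ (proj₂ (fin x) y r)
    within y (inj₂ r') = ∈-++⁺ʳ (proj₁ (fin x)) (proj₂ (fin' x) y r')

element : Subset n → Fin n → ℕ
element T = lookup (proj₁ T)

pair : (x y : ℕ) → x ≢ y → Subset 2
pair x y x≢y = x ∷ y ∷ [] , injective
  where
  injective : Injective _≡_ _≡_ (lookup (x ∷ y ∷ []))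
  injective {fzero}       {fzero}       _   = refl
  injective {fzero}       {fsuc fzero}  x≡y = ⊥-elim (x≢y x≡y)
  injective {fsuc fzero}  {fzero}       y≡x = ⊥-elim (x≢y (sym y≡x))
  injective {fsuc fzero}  {fsuc fzero}  _   = refl

module _ {G : Perm → Set} {S : Rel ℕ 0ℓ} (S-sym : Symmetric S) (S-inv : Invariant G S) where

  geodesic-transport : ∀ {g} → G g → Geodesic S n (app g x) (app g y) → Geodesic S n x y
  geodesic-transport {g = g} Gg =
    geodesic-reflect (app g) from (Inverse.strictlyInverseʳ g)
                     (proj₁ (S-inv g Gg _ _)) from-preserves
    where
    from = Inverse.from g
    from-preserves : S u v → S (from u) (from v)
    from-preserves {u} {v} s =
      proj₂ (S-inv g Gg (from u) (from v))
            (subst₂ S (sym (Inverse.strictlyInverseˡ g u)) (sym (Inverse.strictlyInverseˡ g v)) s)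

  geodesic-orbit-invariant : ∀ {g} (T : Subset 2) (u≢v : u ≢ v) → G g → MapsTo g T (pair u v u≢v) →
                             Geodesic S n u v → Geodesic S n (element T fzero) (element T (fsuc fzero))
  geodesic-orbit-invariant {u = u} {v} {n} {g} T u≢v Gg g[T]≡uv geo =
    by-images (proj₁ (g[T]≡uv _) (_ , (fzero , refl) , refl))
              (proj₁ (g[T]≡uv _) (_ , (fsuc fzero , refl) , refl))
    where
    t₀ = element T fzero
    t₁ = element T (fsuc fzero)
    t₀≢t₁ : app g t₀ ≢ app g t₁
    t₀≢t₁ e with () ← proj₂ T (Injection.injective (↔⇒↣ g) e)
    by-images : app g t₀ ∈ˢ pair u v u≢v → app g t₁ ∈ˢ pair u v u≢v → Geodesic S n t₀ t₁
    by-images (fzero      , e₀) (fzero      , e₁) = ⊥-elim (t₀≢t₁ (trans (sym e₀) e₁))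
    by-images (fsuc fzero , e₀) (fsuc fzero , e₁) = ⊥-elim (t₀≢t₁ (trans (sym e₀) e₁))
    by-images (fzero      , e₀) (fsuc fzero , e₁) =
      geodesic-transport Gg (subst₂ (Geodesic S n) e₀ e₁ geo)
    by-images (fsuc fzero , e₀) (fzero      , e₁) =
      geodesic-transport Gg (subst₂ (Geodesic S n) e₀ e₁ (geodesic-reverse S-sym geo))

module Orbits {G : Perm → Set} (G-oligomorphic : Oligomorphic G) where

  orbitCount : ℕ
  orbitCount = length (proj₁ (G-oligomorphic 2))

  representative : Fin orbitCount → Subset 2
  representative = List.lookup (proj₁ (G-oligomorphic 2))

  orbitIndex : Subset 2 → Fin orbitCount
  orbitIndex T = index (proj₁ (proj₂ (proj₂ (G-oligomorphic 2) T)))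

  representative-mapsTo : ∀ T → ∃[ g ] (G g × MapsTo g (representative (orbitIndex T)) T)
  representative-mapsTo T with _ , T₀∈reps , g[T₀]≡T ← proj₂ (G-oligomorphic 2) T =
    subst (λ T₀ → ∃[ g ] (G g × MapsTo g T₀ T)) (lookup-index T₀∈reps) g[T₀]≡T

  module _ {S : Rel ℕ 0ℓ} (S-sym : Symmetric S) (S-inv : Invariant G S) where

    geodesic-representative : (x≢y : x ≢ y) → Geodesic S n x y →
                              let T = representative (orbitIndex (pair x y x≢y))
                              in Geodesic S n (element T fzero) (element T (fsuc fzero))
    geodesic-representative {x} {y} x≢y geo with g , Gg , g[T]≡xy ← representative-mapsTo (pair x y x≢y) =
      geodesic-orbit-invariant S-sym S-inv (representative (orbitIndex (pair x y x≢y))) x≢y Gg g[T]≡xy geo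

    same-orbit⇒same-distance : (x≢y : x ≢ y) (u≢v : u ≢ v) →
                               orbitIndex (pair x y x≢y) ≡ orbitIndex (pair u v u≢v) →
                               Geodesic S m x y → Geodesic S n u v → m ≡ n
    same-orbit⇒same-distance {m = m} x≢y u≢v same-orbit geo geo' =
      geodesic-length-unique
        (subst (λ i → Geodesic S m (element (representative i) fzero) (element (representative i) (fsuc fzero)))
               same-orbit (geodesic-representative x≢y geo))
        (geodesic-representative u≢v geo')

    geodesic-length≤orbitCount : Geodesic S n x y → n ≤ orbitCount
    geodesic-length≤orbitCount {n} {x} geo with n ≤? orbitCount
    ... | yes n≤r = n≤r
    ... | no  n≰r = ⊥-elim (no-collision (pigeonhole (≰⇒> n≰r) orbitAt))
      where
      pointAt : (i : Fin n) → ∃[ z ] Geodesic S (suc (toℕ i)) x z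
      pointAt i = geodesic-prefix (toℕ<n i) geo
      orbitAt : Fin n → Fin orbitCount
      orbitAt i = orbitIndex (pair x (proj₁ (pointAt i)) (geodesic-suc⇒≢ (proj₂ (pointAt i))))
      no-collision : ¬ ∃₂ λ i j → i Fin.< j × orbitAt i ≡ orbitAt j
      no-collision (i , j , i<j , same-orbit) =
        <-irrefl (suc-injective (same-orbit⇒same-distance _ _ same-orbit
                                   (proj₂ (pointAt i)) (proj₂ (pointAt j)))) i<j

    -- A shortest walk need not exist constructively; instead, a walk whose endpoint
    -- is outside the (decidable) ball is shown to be a geodesic.
    walk⇒∈ball-orbitCount : (nbrs : ℕ → List ℕ) → (∀ {x y} → S x y → y ∈ nbrs x) →
                            Walk S n x y → y ∈ ball nbrs orbitCount x
    walk⇒∈ball-orbitCount {n} {x} nbrs adj = <-rec _ shortest n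
      where
      shortest : ∀ k → (∀ {m} → m < k → ∀ {y} → Walk S m x y → y ∈ ball nbrs orbitCount x) →
                 ∀ {y} → Walk S k x y → y ∈ ball nbrs orbitCount x
      shortest k shorter {y} w with y ∈? ball nbrs orbitCount x
      ... | yes y∈ball = y∈ball
      ... | no  y∉ball = walk⇒∈ball nbrs adj w
        (geodesic-length≤orbitCount (w , λ m<n v → y∉ball (shorter m<n v)))

lemma3p11 : (G : Perm → Set) → IsPermGroup G → Oligomorphic G →
    (B B' : Rel ℕ 0ℓ) → IsBlockSystem G B → IsBlockSystem G B' →
    FiniteBlocks B → FiniteBlocks B' → FiniteBlocks (Join B B')
lemma3p11 G _ G-oligomorphic B B' 𝓑 𝓑' finite finite' x =
  ball nbrs orbitCount x ,
  λ y x∼y → walk⇒∈ball-orbitCount S-sym S-inv nbrs (λ {u} {v} s → proj₂ (S-finite u) v s)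
              (proj₂ (star⇒walk (Star.map (SymClosure.fold S-sym id) x∼y)))
  where
  open Orbits G-oligomorphic
  open IsBlockSystem
  S : Rel ℕ 0ℓ
  S = B ∪ B'
  S-sym : Symmetric S
  S-sym = Union.symmetric {L = B} {R = B'} (IsEquivalence.sym (isEquivalence 𝓑))
                                         (IsEquivalence.sym (isEquivalence 𝓑'))
  S-inv : Invariant G S
  S-inv = ∪-invariant (invariant 𝓑) (invariant 𝓑')
  S-finite : FiniteBlocks S
  S-finite = ∪-finiteBlocks finite finite'
  nbrs : ℕ → List ℕ
  nbrs u = proj₁ (S-finite u)
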